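{- For every even non-splitting perfect polynomial $B\in\mathbb{F}_2[x]$, the set of odd irreducible divisors of $B$ is admissible.
   Context: $\sigma(A)$ denotes the sum of all divisors of $A\in\mathbb{F}_2[x]$; $A$ is perfect if $\sigma(A)=A$. A polynomial is even if it has a linear factor, odd otherwise; it is non-splitting if it is not a product of linear factors. $\overline{T}(x):=T(x+1)$, $T^*(x):=x^{\deg T}T(1/x)$. A polynomial "factors in" a family $\mathcal{G}$ if all its irreducible factors belong to $\mathcal{G}$. A family $\mathcal{G}$ of odd irreducible polynomials is admissible if it satisfies at least one of: (i) for every $T\in\mathcal{G}$, $T^*\in\mathcal{G}$ or $\overline{T}\in\mathcal{G}$; (ii) there exists a positive integer $h$ such that $\sigma(x^{2h})$ or $\sigma((x+1)^{2h})$ factors in $\mathcal{G}$; (iii) for every $T\in\mathcal{G}$, $1+T$ or $\sigma(T^{2h})$ (for some positive integer $h$) factors in $\mathcal{G}\cup\{x,x+1\}$. -}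

module Defs where

open import Data.Bool using (Bool; true; false; _xor_; if_then_else_)
open import Data.List using (List; []; _∷_; foldr; reverse)
open import Data.List.Membership.Propositional using (_∈_)
open import Data.List.Relation.Unary.All using (All)
open import Data.List.Relation.Unary.Unique.Propositional using (Unique)
open import Data.Nat using (ℕ; zero; suc; _*_; _≥_)
open import Data.Product using (Σ; _×_; ∃; ∃-syntax)
open import Data.Sum using (_⊎_)
open import Relation.Binary.PropositionalEquality using (_≡_)
open import Relation.Nullary using (¬_)

-- Polynomials over F₂: coefficient lists, lowest degree first
-- (index i = coefficient of x^i).  Trailing zeros are allowed in the
-- representation; equality of polynomials is _≈_ (equal normal forms).
Poly : Set
Poly = List Bool

consN : Bool → Poly → Poly
consN false [] = []
consN b q = b ∷ q

norm : Poly → Poly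
norm [] = []
norm (b ∷ p) = consN b (norm p)

Normal : Poly → Set
Normal p = norm p ≡ p

_≈_ : Poly → Poly → Set
p ≈ q = norm p ≡ norm q

infix 4 _≈_ _∣_
infixl 6 _+ₚ_
infixl 7 _*ₚ_

_+ₚ_ : Poly → Poly → Poly
[] +ₚ q = q
(a ∷ p) +ₚ [] = a ∷ p
(a ∷ p) +ₚ (b ∷ q) = (a xor b) ∷ (p +ₚ q)

_*ₚ_ : Poly → Poly → Poly
[] *ₚ q = []
(a ∷ p) *ₚ q = (if a then q else []) +ₚ (false ∷ (p *ₚ q))

zeroP oneP X X1 : Poly
zeroP = []
oneP = true ∷ []
X = false ∷ true ∷ []
X1 = true ∷ true ∷ []

_^ₚ_ : Poly → ℕ → Poly
p ^ₚ zero = oneP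
p ^ₚ suc n = p *ₚ (p ^ₚ n)

compose : Poly → Poly → Poly
compose [] S = []
compose (c ∷ p) S = (c ∷ []) +ₚ (S *ₚ compose p S)

bar : Poly → Poly
bar T = compose T X1

-- T*(x) = x^{deg T} T(1/x): reverse the normalised coefficient list
recip : Poly → Poly
recip T = reverse (norm T)

_∣_ : Poly → Poly → Set
D ∣ A = ∃[ Q ] (Q *ₚ D ≈ A)

-- irreducible: not zero, not a unit (the only unit of F₂[x] is 1),
-- and every divisor is a unit or an associate (= itself over F₂)
Irreducible : Poly → Set
Irreducible P = ¬ (P ≈ zeroP) × ¬ (P ≈ oneP) × (∀ D → D ∣ P → D ≈ oneP ⊎ D ≈ P)

sumP : List Poly → Poly
sumP = foldr _+ₚ_ zeroP

DivisorList : Poly → List Poly → Set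
DivisorList A L =
  All Normal L × Unique L ×
  (∀ D → Normal D → (D ∈ L → (¬ (D ≈ zeroP) × D ∣ A)) × ((¬ (D ≈ zeroP) × D ∣ A) → D ∈ L))

IsSigma : Poly → Poly → Set
IsSigma A S = ∃[ L ] (DivisorList A L × sumP L ≈ S)

Perfect : Poly → Set
Perfect A = IsSigma A A

Even : Poly → Set
Even A = X ∣ A ⊎ X1 ∣ A

Odd : Poly → Set
Odd A = ¬ (X ∣ A) × ¬ (X1 ∣ A)

NonSplitting : Poly → Set
NonSplitting A = ¬ (∃[ a ] ∃[ b ] (A ≈ (X ^ₚ a) *ₚ (X1 ^ₚ b)))

Family : Set₁
Family = Poly → Set

FactorsIn : Family → Poly → Set
FactorsIn G A = ∀ P → Irreducible P → P ∣ A → G P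

SigmaFactorsIn : Family → Poly → Set
SigmaFactorsIn G A = ∃[ S ] (IsSigma A S × FactorsIn G S)

withLinear : Family → Family
withLinear G P = G P ⊎ P ≈ X ⊎ P ≈ X1

Admissible : Family → Set
Admissible G =
  (∀ T → G T → Odd T × Irreducible T) ×
  ( (∀ T → G T → G (recip T) ⊎ G (bar T))
  ⊎ (∃[ h ] (h ≥ 1 × (SigmaFactorsIn G (X ^ₚ (2 * h)) ⊎ SigmaFactorsIn G (X1 ^ₚ (2 * h)))))
  ⊎ (∀ T → G T → FactorsIn (withLinear G) (oneP +ₚ T)
                 ⊎ ∃[ h ] (h ≥ 1 × SigmaFactorsIn (withLinear G) (T ^ₚ (2 * h)))))

OddIrreducibleDivisors : Poly → Family
OddIrreducibleDivisors B T = Odd T × Irreducible T × T ∣ B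

-- Let T be an odd irreducible divisor of the perfect polynomial B and write B = Tᵉ C with T ∤ C.
-- The divisors of B are exactly the products Tⁱ D with i ≤ e and D ∣ C, so
-- σ(B) = σ(Tᵉ) σ(C) and σ(Tᵉ) divides σ(B) = B. Every irreducible factor of σ(Tᵉ) is therefore
-- x, x + 1 or an odd irreducible divisor of B. For even e this is condition (iii) with 2h = e;
-- for odd e, σ(Tᵉ) = (1 + T)(1 + T² + ⋯ + Tᵉ⁻¹), so 1 + T factors in the family instead.
module Submission where

open import Algebra.Bundles using (CommutativeSemiring; CommutativeRing)
import Algebra.Solver.Ring as RingSolver
import Algebra.Solver.Ring.AlmostCommutativeRing as ACR
open import Data.Bool using (Bool; true; false; _xor_; _∧_; if_then_else_)
open import Data.Bool.Properties using (xor-∧-commutativeRing) renaming (_≟_ to _≟ᵇ_)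
open import Data.Bool.Solver using (module xor-∧-Solver)
open import Data.Empty using (⊥-elim)
open import Data.List using (List; []; _∷_; length; map; _++_; filter)
open import Data.List.Membership.Propositional using (_∈_)
open import Data.List.Membership.Propositional.Properties
  using (∈-++⁺ˡ; ∈-++⁺ʳ; ∈-++⁻; ∈-map⁺; ∈-map⁻; ∈-filter⁺; ∈-filter⁻)
open import Data.List.Membership.Propositional.Properties.WithK using (unique∧set⇒bag)
open import Data.List.Relation.Binary.BagAndSetEquality using (∼bag⇒↭)
open import Data.List.Relation.Binary.Disjoint.Propositional using (Disjoint)
open import Data.List.Relation.Binary.Permutation.Propositional using (↭⇒↭ₛ′)
import Data.List.Relation.Binary.Permutation.Setoid.Properties as Permutation
open import Data.List.Relation.Unary.All as All using (All; []; _∷_)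
open import Data.List.Relation.Unary.AllPairs using ([]; _∷_)
open import Data.List.Relation.Unary.Any using (here; there)
open import Data.List.Relation.Unary.Unique.Propositional using (Unique)
import Data.List.Relation.Unary.Unique.Propositional.Properties as Unique
open import Data.Maybe using (Maybe; just; nothing)
open import Data.Nat using (ℕ; zero; suc; _+_; _*_; _≤_; _<_; _≥_; z≤n; s≤s)
open import Data.Nat.Induction using (<-wellFounded)
open import Data.Nat.Properties
  using (≤-refl; ≤-trans; ≤-pred; <-trans; <-irrefl; <-cmp; m≤n⇒m≤1+n; m≤n⇒m<n∨m≡n;
         m≤m+n; m≤n+m; m<m+n; m+n≡0⇒n≡0; m≤n⇒∃[o]m+o≡n; *-suc)
open import Data.Product using (Σ; _×_; ∃-syntax; _,_; proj₁; proj₂)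
open import Data.Sum using (_⊎_; inj₁; inj₂)
open import Defs
open import Function.Bundles using (mk⇔)
open import Induction.WellFounded using (Acc; acc)
open import Relation.Binary.Definitions using (tri<; tri≈; tri>)
open import Relation.Binary.PropositionalEquality using (_≡_; refl; sym; trans; cong; cong₂; subst)
import Relation.Binary.Reasoning.Setoid as SetoidReasoning
open import Relation.Binary.Structures using (IsEquivalence)
open import Relation.Nullary using (¬_; Dec; yes; no)

coeff : Poly → ℕ → Bool
coeff [] _ = false
coeff (b ∷ p) zero = b
coeff (b ∷ p) (suc i) = coeff p i

infix 4 _≋_
record _≋_ (p q : Poly) : Set where
  constructor mk≋
  field coeff≡ : ∀ i → coeff p i ≡ coeff q i
open _≋_ public

≋-refl : ∀ {p} → p ≋ p
≋-refl = mk≋ λ i → refl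

≋-sym : ∀ {p q} → p ≋ q → q ≋ p
≋-sym e = mk≋ λ i → sym (coeff≡ e i)

≋-trans : ∀ {p q r} → p ≋ q → q ≋ r → p ≋ r
≋-trans e f = mk≋ λ i → trans (coeff≡ e i) (coeff≡ f i)

∷-cong : ∀ a {p q} → p ≋ q → a ∷ p ≋ a ∷ q
∷-cong a e = mk≋ λ { zero → refl ; (suc i) → coeff≡ e i }

∷-tail : ∀ {a b p q} → a ∷ p ≋ b ∷ q → p ≋ q
∷-tail e = mk≋ λ i → coeff≡ e (suc i)

∷-tailˡ : ∀ {a p} → a ∷ p ≋ [] → p ≋ []
∷-tailˡ e = mk≋ λ i → coeff≡ e (suc i)

false∷[]≋[] : false ∷ [] ≋ []
false∷[]≋[] = mk≋ λ { zero → refl ; (suc i) → refl }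

coeff-consN : ∀ b p i → coeff (consN b p) i ≡ coeff (b ∷ p) i
coeff-consN false [] zero = refl
coeff-consN false [] (suc i) = refl
coeff-consN false (_ ∷ _) i = refl
coeff-consN true p i = refl

norm-≋ : ∀ p → norm p ≋ p
norm-≋ [] = ≋-refl
norm-≋ (b ∷ p) = mk≋ λ i → trans (coeff-consN b (norm p) i) (coeff≡ (∷-cong b (norm-≋ p)) i)

consN-normal : ∀ b {p} → Normal p → Normal (consN b p)
consN-normal false {[]} n = refl
consN-normal false {_ ∷ _} n = cong (consN false) n
consN-normal true n = cong (consN true) n

norm-normal : ∀ p → Normal (norm p)
norm-normal [] = refl
norm-normal (b ∷ p) = consN-normal b (norm-normal p)

consN-injective : ∀ b {p q} → consN b p ≡ b ∷ q → p ≡ q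
consN-injective true refl = refl
consN-injective false {_ ∷ _} refl = refl

tail-normal : ∀ {b p} → Normal (b ∷ p) → Normal p
tail-normal {b} = consN-injective b

-- A normal polynomial whose coefficients all vanish is [], since its last entry is true.
normal-≋[]⇒≡[] : ∀ {p} → Normal p → p ≋ [] → p ≡ []
normal-≋[]⇒≡[] {[]} n e = refl
normal-≋[]⇒≡[] {b ∷ p} n e with normal-≋[]⇒≡[] (tail-normal {b} n) (∷-tailˡ e)
normal-≋[]⇒≡[] {false ∷ .[]} () e | refl
normal-≋[]⇒≡[] {true ∷ .[]} n e | refl with coeff≡ e zero
... | ()

normal-≋⇒≡ : ∀ {p q} → Normal p → Normal q → p ≋ q → p ≡ q
normal-≋⇒≡ {[]} np nq e = sym (normal-≋[]⇒≡[] nq (≋-sym e))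
normal-≋⇒≡ {_ ∷ _} {[]} np nq e = normal-≋[]⇒≡[] np e
normal-≋⇒≡ {a ∷ p} {b ∷ q} np nq e =
  cong₂ _∷_ (coeff≡ e zero) (normal-≋⇒≡ (tail-normal {a} np) (tail-normal {b} nq) (∷-tail e))

≈⇒≋ : ∀ {p q} → p ≈ q → p ≋ q
≈⇒≋ {p} {q} e = ≋-trans (≋-sym (norm-≋ p)) (subst (_≋ q) (sym e) (norm-≋ q))

≋⇒≈ : ∀ {p q} → p ≋ q → p ≈ q
≋⇒≈ {p} {q} e = normal-≋⇒≡ (norm-normal p) (norm-normal q)
  (≋-trans (norm-≋ p) (≋-trans e (≋-sym (norm-≋ q))))

-- The commutative semiring F₂[x]

open xor-∧-Solver using (solve; _:+_; _:*_; _:=_; con)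

scale : Bool → Poly → Poly
scale a q = if a then q else []

shift : Poly → Poly
shift p = false ∷ p

coeff-scale : ∀ a q i → coeff (scale a q) i ≡ a ∧ coeff q i
coeff-scale false q i = refl
coeff-scale true q i = refl

coeff-+ : ∀ p q i → coeff (p +ₚ q) i ≡ coeff p i xor coeff q i
coeff-+ [] q i = refl
coeff-+ (a ∷ p) [] i = sym (solve 1 (λ x → x :+ con false := x) refl (coeff (a ∷ p) i))
coeff-+ (a ∷ p) (b ∷ q) zero = refl
coeff-+ (a ∷ p) (b ∷ q) (suc i) = coeff-+ p q i

+ₚ-cong : ∀ {p p′ q q′} → p ≋ p′ → q ≋ q′ → p +ₚ q ≋ p′ +ₚ q′
+ₚ-cong {p} {p′} {q} {q′} e f = mk≋ λ i →
  trans (coeff-+ p q i) (trans (cong₂ _xor_ (coeff≡ e i) (coeff≡ f i)) (sym (coeff-+ p′ q′ i)))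

+ₚ-comm : ∀ p q → p +ₚ q ≋ q +ₚ p
+ₚ-comm p q = mk≋ λ i → trans (coeff-+ p q i)
  (trans (solve 2 (λ a b → a :+ b := b :+ a) refl (coeff p i) (coeff q i)) (sym (coeff-+ q p i)))

+ₚ-assoc : ∀ p q r → (p +ₚ q) +ₚ r ≋ p +ₚ (q +ₚ r)
+ₚ-assoc p q r = mk≋ λ i → trans (coeff-+ (p +ₚ q) r i) (trans (cong (_xor coeff r i) (coeff-+ p q i))
  (trans (solve 3 (λ a b d → (a :+ b) :+ d := a :+ (b :+ d)) refl (coeff p i) (coeff q i) (coeff r i))
  (sym (trans (coeff-+ p (q +ₚ r) i) (cong (coeff p i xor_) (coeff-+ q r i))))))

+ₚ-identityʳ : ∀ p → p +ₚ [] ≋ p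
+ₚ-identityʳ p = mk≋ λ i → trans (coeff-+ p [] i) (solve 1 (λ a → a :+ con false := a) refl (coeff p i))

+ₚ-self : ∀ p → p +ₚ p ≋ []
+ₚ-self p = mk≋ λ i → trans (coeff-+ p p i) (solve 1 (λ a → a :+ a := con false) refl (coeff p i))

shift-cong : ∀ {p q} → p ≋ q → shift p ≋ shift q
shift-cong = ∷-cong false

shift-[] : shift [] ≋ []
shift-[] = false∷[]≋[]

scale-cong : ∀ a {p q} → p ≋ q → scale a p ≋ scale a q
scale-cong false e = ≋-refl
scale-cong true e = e

*ₚ-zeroˡ-≋ : ∀ {p} → p ≋ [] → ∀ q → p *ₚ q ≋ []
*ₚ-zeroˡ-≋ {[]} e q = ≋-refl
*ₚ-zeroˡ-≋ {false ∷ p} e q = ≋-trans (shift-cong (*ₚ-zeroˡ-≋ (∷-tailˡ e) q)) shift-[]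
*ₚ-zeroˡ-≋ {true ∷ p} e q with coeff≡ e zero
... | ()

*ₚ-congˡ : ∀ {p p′} → p ≋ p′ → ∀ q → p *ₚ q ≋ p′ *ₚ q
*ₚ-congˡ {[]} e q = ≋-sym (*ₚ-zeroˡ-≋ (≋-sym e) q)
*ₚ-congˡ {_ ∷ _} {[]} e q = *ₚ-zeroˡ-≋ e q
*ₚ-congˡ {a ∷ p} {b ∷ p′} e q with refl ← coeff≡ e zero =
  +ₚ-cong {scale a q} ≋-refl (shift-cong (*ₚ-congˡ (∷-tail e) q))

*ₚ-congʳ : ∀ p {q q′} → q ≋ q′ → p *ₚ q ≋ p *ₚ q′
*ₚ-congʳ [] e = ≋-refl
*ₚ-congʳ (a ∷ p) e = +ₚ-cong (scale-cong a e) (shift-cong (*ₚ-congʳ p e))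

*ₚ-cong : ∀ {p p′ q q′} → p ≋ p′ → q ≋ q′ → p *ₚ q ≋ p′ *ₚ q′
*ₚ-cong {p′ = p′} {q} e f = ≋-trans (*ₚ-congˡ e q) (*ₚ-congʳ p′ f)

*ₚ-zeroʳ : ∀ p → p *ₚ [] ≋ []
*ₚ-zeroʳ [] = ≋-refl
*ₚ-zeroʳ (false ∷ p) = ≋-trans (shift-cong (*ₚ-zeroʳ p)) shift-[]
*ₚ-zeroʳ (true ∷ p) = ≋-trans (shift-cong (*ₚ-zeroʳ p)) shift-[]

*ₚ-zeroʳ-≋ : ∀ p {q} → q ≋ [] → p *ₚ q ≋ []
*ₚ-zeroʳ-≋ p q≋0 = ≋-trans (*ₚ-congʳ p q≋0) (*ₚ-zeroʳ p)

+ₚ-identityʳ-≋ : ∀ p {q} → q ≋ [] → p +ₚ q ≋ p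
+ₚ-identityʳ-≋ p q≋0 = ≋-trans (+ₚ-cong {p} ≋-refl q≋0) (+ₚ-identityʳ p)

coeff-scale+shift : ∀ a q r i → coeff (scale a q +ₚ shift r) i ≡ (a ∧ coeff q i) xor coeff (shift r) i
coeff-scale+shift a q r i = trans (coeff-+ (scale a q) (shift r) i) (cong (_xor coeff (shift r) i) (coeff-scale a q i))

*ₚ-distribʳ-+ : ∀ q p p′ → (p +ₚ p′) *ₚ q ≋ p *ₚ q +ₚ p′ *ₚ q
*ₚ-distribʳ-+ q [] p′ = ≋-refl
*ₚ-distribʳ-+ q (a ∷ p) [] = ≋-sym (+ₚ-identityʳ _)
*ₚ-distribʳ-+ q (a ∷ p) (b ∷ p′) =
  ≋-trans (+ₚ-cong {scale (a xor b) q} ≋-refl (shift-cong (*ₚ-distribʳ-+ q p p′))) (mk≋ pointwise)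
  where
  rhs : ∀ i → coeff ((scale a q +ₚ shift (p *ₚ q)) +ₚ (scale b q +ₚ shift (p′ *ₚ q))) i
            ≡ ((a ∧ coeff q i) xor coeff (shift (p *ₚ q)) i) xor ((b ∧ coeff q i) xor coeff (shift (p′ *ₚ q)) i)
  rhs i = trans (coeff-+ (scale a q +ₚ shift (p *ₚ q)) _ i)
                (cong₂ _xor_ (coeff-scale+shift a q _ i) (coeff-scale+shift b q _ i))
  pointwise : ∀ i → coeff (scale (a xor b) q +ₚ shift (p *ₚ q +ₚ p′ *ₚ q)) i
                  ≡ coeff ((scale a q +ₚ shift (p *ₚ q)) +ₚ (scale b q +ₚ shift (p′ *ₚ q))) i
  pointwise zero = trans (coeff-scale+shift (a xor b) q _ zero) (trans
    (solve 3 (λ a b x → (a :+ b) :* x :+ con false := (a :* x :+ con false) :+ (b :* x :+ con false))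
      refl a b (coeff q zero))
    (sym (rhs zero)))
  pointwise (suc i) = trans (coeff-scale+shift (a xor b) q _ (suc i))
    (trans (cong (((a xor b) ∧ coeff q (suc i)) xor_) (coeff-+ (p *ₚ q) (p′ *ₚ q) i))
    (trans (solve 5 (λ a b x y z → (a :+ b) :* x :+ (y :+ z) := (a :* x :+ y) :+ (b :* x :+ z))
      refl a b (coeff q (suc i)) (coeff (p *ₚ q) i) (coeff (p′ *ₚ q) i))
    (sym (rhs (suc i)))))

*ₚ-∷ʳ : ∀ q a p → q *ₚ (a ∷ p) ≋ scale a q +ₚ shift (q *ₚ p)
*ₚ-∷ʳ [] false p = ≋-sym shift-[]
*ₚ-∷ʳ [] true p = ≋-sym shift-[]
*ₚ-∷ʳ (b ∷ q) a p = ≋-trans (+ₚ-cong {scale b (a ∷ p)} ≋-refl (shift-cong (*ₚ-∷ʳ q a p))) (mk≋ pointwise)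
  where
  pointwise : ∀ i → coeff (scale b (a ∷ p) +ₚ shift (scale a q +ₚ shift (q *ₚ p))) i
                  ≡ coeff (scale a (b ∷ q) +ₚ shift (scale b p +ₚ shift (q *ₚ p))) i
  pointwise zero = trans (coeff-scale+shift b (a ∷ p) _ zero)
    (trans (solve 2 (λ a b → b :* a :+ con false := a :* b :+ con false) refl a b)
    (sym (coeff-scale+shift a (b ∷ q) _ zero)))
  pointwise (suc i) = trans (coeff-scale+shift b (a ∷ p) _ (suc i))
    (trans (cong ((b ∧ coeff p i) xor_) (coeff-scale+shift a q (q *ₚ p) i))
    (trans (solve 5 (λ a b x y z → b :* x :+ (a :* y :+ z) := a :* y :+ (b :* x :+ z))
      refl a b (coeff p i) (coeff q i) (coeff (shift (q *ₚ p)) i))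
    (sym (trans (coeff-scale+shift a (b ∷ q) _ (suc i))
                (cong ((a ∧ coeff q i) xor_) (coeff-scale+shift b p (q *ₚ p) i))))))

*ₚ-comm : ∀ p q → p *ₚ q ≋ q *ₚ p
*ₚ-comm [] q = ≋-sym (*ₚ-zeroʳ q)
*ₚ-comm (a ∷ p) q = ≋-trans (+ₚ-cong {scale a q} ≋-refl (shift-cong (*ₚ-comm p q))) (≋-sym (*ₚ-∷ʳ q a p))

*ₚ-distribˡ-+ : ∀ p q q′ → p *ₚ (q +ₚ q′) ≋ p *ₚ q +ₚ p *ₚ q′
*ₚ-distribˡ-+ p q q′ = ≋-trans (*ₚ-comm p (q +ₚ q′))
  (≋-trans (*ₚ-distribʳ-+ p q q′) (+ₚ-cong (*ₚ-comm q p) (*ₚ-comm q′ p)))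

scale-* : ∀ a q r → scale a q *ₚ r ≋ scale a (q *ₚ r)
scale-* false q r = ≋-refl
scale-* true q r = ≋-refl

*ₚ-assoc : ∀ p q r → (p *ₚ q) *ₚ r ≋ p *ₚ (q *ₚ r)
*ₚ-assoc [] q r = ≋-refl
*ₚ-assoc (a ∷ p) q r = ≋-trans (*ₚ-distribʳ-+ r (scale a q) (shift (p *ₚ q)))
  (+ₚ-cong (scale-* a q r) (shift-cong (*ₚ-assoc p q r)))

*ₚ-identityˡ : ∀ q → oneP *ₚ q ≋ q
*ₚ-identityˡ q = ≋-trans (+ₚ-cong {q} ≋-refl shift-[]) (+ₚ-identityʳ q)

*ₚ-identityʳ : ∀ q → q *ₚ oneP ≋ q
*ₚ-identityʳ q = ≋-trans (*ₚ-comm q oneP) (*ₚ-identityˡ q)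

≋-isEquivalence : IsEquivalence _≋_
≋-isEquivalence = record { refl = ≋-refl ; sym = ≋-sym ; trans = ≋-trans }

polySemiring : CommutativeSemiring _ _
polySemiring = record
  { Carrier = Poly ; _≈_ = _≋_ ; _+_ = _+ₚ_ ; _*_ = _*ₚ_ ; 0# = [] ; 1# = oneP
  ; isCommutativeSemiring = record
    { isSemiring = record
      { isSemiringWithoutAnnihilatingZero = record
        { +-isCommutativeMonoid = record
          { isMonoid = record
            { isSemigroup = record
              { isMagma = record { isEquivalence = ≋-isEquivalence ; ∙-cong = +ₚ-cong }
              ; assoc = +ₚ-assoc }
            ; identity = (λ _ → ≋-refl) , +ₚ-identityʳ }
          ; comm = +ₚ-comm }
        ; *-cong = *ₚ-cong
        ; *-assoc = *ₚ-assoc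
        ; *-identity = *ₚ-identityˡ , *ₚ-identityʳ
        ; distrib = *ₚ-distribˡ-+ , *ₚ-distribʳ-+ }
      ; zero = (λ _ → ≋-refl) , *ₚ-zeroʳ }
    ; *-comm = *ₚ-comm } }

module ≋-Reasoning = SetoidReasoning (CommutativeSemiring.setoid polySemiring)

constP : Bool → Poly
constP a = a ∷ []

constP-morphism : ACR._-Raw-AlmostCommutative⟶_ (CommutativeRing.rawRing xor-∧-commutativeRing)
                                                  (ACR.fromCommutativeSemiring polySemiring)
constP-morphism = record
  { ⟦_⟧ = constP
  ; +-homo = λ _ _ → ≋-refl
  ; *-homo = *-homo
  ; -‿homo = λ _ → ≋-refl
  ; 0-homo = false∷[]≋[]
  ; 1-homo = ≋-refl }
  where
  *-homo : ∀ a b → constP (a ∧ b) ≋ constP a *ₚ constP b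
  *-homo false b = ≋-refl
  *-homo true false = ≋-refl
  *-homo true true = ≋-refl

constP-≟ : ∀ a b → Maybe (constP a ≋ constP b)
constP-≟ a b with a ≟ᵇ b
... | yes refl = just ≋-refl
... | no _ = nothing

open RingSolver (CommutativeRing.rawRing xor-∧-commutativeRing)
  (ACR.fromCommutativeSemiring polySemiring) constP-morphism constP-≟
  using () renaming (solve to ring; _:+_ to _⊕_; _:*_ to _⊗_; _:=_ to _≐_; con to ⟨_⟩)

-- Degrees

record VanishesFrom (p : Poly) (d : ℕ) : Set where
  constructor vanishes
  field coeff-vanishes : ∀ k → d ≤ k → coeff p k ≡ false
open VanishesFrom public

HasDeg : Poly → ℕ → Set
HasDeg p d = coeff p d ≡ true × VanishesFrom p (suc d)

vanishes-≋ : ∀ {p q d} → p ≋ q → VanishesFrom p d → VanishesFrom q d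
vanishes-≋ e v = vanishes λ k le → trans (sym (coeff≡ e k)) (coeff-vanishes v k le)

vanishes-mono : ∀ {p d d′} → d ≤ d′ → VanishesFrom p d → VanishesFrom p d′
vanishes-mono le v = vanishes λ k le′ → coeff-vanishes v k (≤-trans le le′)

vanishes-+ : ∀ {p q d} → VanishesFrom p d → VanishesFrom q d → VanishesFrom (p +ₚ q) d
vanishes-+ {p} {q} vp vq = vanishes λ k le →
  trans (coeff-+ p q k) (cong₂ _xor_ (coeff-vanishes vp k le) (coeff-vanishes vq k le))

vanishes-scale : ∀ a {p d} → VanishesFrom p d → VanishesFrom (scale a p) d
vanishes-scale false v = vanishes λ _ _ → refl
vanishes-scale true v = v

vanishes-∷ : ∀ a {p d} → VanishesFrom p d → VanishesFrom (a ∷ p) (suc d)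
vanishes-∷ a v = vanishes λ { (suc k) (s≤s le) → coeff-vanishes v k le }

vanishes-tail : ∀ {a p d} → VanishesFrom (a ∷ p) (suc d) → VanishesFrom p d
vanishes-tail v = vanishes λ k le → coeff-vanishes v (suc k) (s≤s le)

vanishes-0 : ∀ {p} → VanishesFrom p 0 → p ≋ []
vanishes-0 v = mk≋ λ k → coeff-vanishes v k z≤n

vanishes-lower : ∀ {p d} → VanishesFrom p (suc d) → coeff p d ≡ false → VanishesFrom p d
vanishes-lower {p} {d} v pd≡false = vanishes from-d
  where
  from-d : ∀ k → d ≤ k → coeff p k ≡ false
  from-d k le with m≤n⇒m<n∨m≡n le
  ... | inj₁ d<k = coeff-vanishes v k d<k
  ... | inj₂ refl = pd≡false

hasDeg-≋ : ∀ {p q d} → p ≋ q → HasDeg p d → HasDeg q d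
hasDeg-≋ e (lead , v) = trans (sym (coeff≡ e _)) lead , vanishes-≋ e v

hasDeg-∷ : ∀ a {p d} → HasDeg p d → HasDeg (a ∷ p) (suc d)
hasDeg-∷ a (lead , v) = lead , vanishes-∷ a v

hasDeg-+ˡ : ∀ {p q d} → VanishesFrom p d → HasDeg q d → HasDeg (p +ₚ q) d
hasDeg-+ˡ {p} {q} {d} vp (lead , vq) =
  trans (coeff-+ p q d) (cong₂ _xor_ (coeff-vanishes vp d ≤-refl) lead) ,
  vanishes-+ (vanishes-mono (m≤n⇒m≤1+n ≤-refl) vp) vq

hasDeg⇒≉0 : ∀ {p d} → HasDeg p d → ¬ (p ≋ [])
hasDeg⇒≉0 (lead , _) e with trans (sym lead) (coeff≡ e _)
... | ()

≋0⊎hasDeg : ∀ p → p ≋ [] ⊎ ∃[ d ] HasDeg p d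
≋0⊎hasDeg [] = inj₁ ≋-refl
≋0⊎hasDeg (a ∷ p) with ≋0⊎hasDeg p
≋0⊎hasDeg (false ∷ p) | inj₁ e = inj₁ (≋-trans (∷-cong false e) false∷[]≋[])
≋0⊎hasDeg (true ∷ p) | inj₁ e = inj₂ (0 , refl , vanishes-∷ true (vanishes λ k _ → coeff≡ e k))
... | inj₂ (d , dp) = inj₂ (suc d , hasDeg-∷ a dp)

hasDeg<vanishes : ∀ {p k m} → HasDeg p k → VanishesFrom p m → k < m
hasDeg<vanishes {p} {k} {m} (lead , _) v with <-cmp k m
... | tri< k<m _ _ = k<m
... | tri≈ _ refl _ with () ← trans (sym lead) (coeff-vanishes v k ≤-refl)
... | tri> _ _ m<k with () ← trans (sym lead) (coeff-vanishes v k (≤-trans (m≤n⇒m≤1+n ≤-refl) m<k))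

hasDeg-unique : ∀ {p m n} → HasDeg p m → HasDeg p n → m ≡ n
hasDeg-unique {m = m} {n} dm@(_ , vm) dn@(_ , vn) with <-cmp m n
... | tri< m<n _ _ = ⊥-elim (<-irrefl refl (≤-trans (hasDeg<vanishes dn vm) m<n))
... | tri≈ _ m≡n _ = m≡n
... | tri> _ _ n<m = ⊥-elim (<-irrefl refl (≤-trans (hasDeg<vanishes dm vn) n<m))

hasDeg-* : ∀ {p q m n} → HasDeg p m → HasDeg q n → HasDeg (p *ₚ q) (m + n)
hasDeg-* {[]} (() , _) _
hasDeg-* {false ∷ p} {m = zero} (() , _) _
hasDeg-* {true ∷ p} {q} {zero} (_ , v) dq =
  hasDeg-≋ (≋-sym (+ₚ-identityʳ-≋ q (≋-trans (shift-cong (*ₚ-zeroˡ-≋ (vanishes-0 (vanishes-tail v)) q)) shift-[]))) dq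
hasDeg-* {a ∷ p} {q} {suc m} {n} (lead , v) dq@(_ , vq) =
  hasDeg-+ˡ (vanishes-scale a (vanishes-mono (s≤s (m≤n+m n m)) vq))
            (hasDeg-∷ false (hasDeg-* {p} (lead , vanishes-tail v) dq))

*ₚ-≉0 : ∀ {p q} → ¬ (p ≋ []) → ¬ (q ≋ []) → ¬ (p *ₚ q ≋ [])
*ₚ-≉0 {p} {q} p≉0 q≉0 with ≋0⊎hasDeg p | ≋0⊎hasDeg q
... | inj₁ p≋0 | _ = ⊥-elim (p≉0 p≋0)
... | inj₂ _ | inj₁ q≋0 = ⊥-elim (q≉0 q≋0)
... | inj₂ (_ , dp) | inj₂ (_ , dq) = hasDeg⇒≉0 (hasDeg-* dp dq)

-- Division with remainder and divisibility

-- Over F₂ subtraction is addition, so A ≋ B + C can be solved for either summand.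
+ₚ-moveʳ : ∀ {A B C} → A ≋ B +ₚ C → C ≋ A +ₚ B
+ₚ-moveʳ {A} {B} {C} e = ≋-trans (ring 2 (λ b c → c ≐ (b ⊕ c) ⊕ b) ≋-refl B C) (+ₚ-cong (≋-sym e) ≋-refl)

-- a ∷ A is a + x A: divide A, then clear the degree-d coefficient of the shifted remainder with D.
divMod : ∀ A {D d} → HasDeg D d → Σ Poly λ Q → Σ Poly λ R → (A ≋ Q *ₚ D +ₚ R) × VanishesFrom R d
divMod [] dD = [] , [] , ≋-refl , vanishes λ _ _ → refl
divMod (a ∷ A) {D} {d} dD with divMod A dD
... | Q , R , A≋QD+R , vR with coeff (a ∷ R) d in aR-d
...   | false = false ∷ Q , a ∷ R , ∷-cong a A≋QD+R , vanishes-lower (vanishes-∷ a vR) aR-d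
...   | true = true ∷ Q , (a ∷ R) +ₚ D ,
               ≋-trans (∷-cong a A≋QD+R)
                       (ring 3 (λ x y z → x ⊕ y ≐ (z ⊕ x) ⊕ (y ⊕ z)) ≋-refl (shift (Q *ₚ D)) (a ∷ R) D) ,
               vanishes-lower (vanishes-+ (vanishes-∷ a vR) (proj₂ dD))
                 (trans (coeff-+ (a ∷ R) D d) (cong₂ _xor_ aR-d (proj₁ dD)))

infix 4 _∣≋_
_∣≋_ : Poly → Poly → Set
D ∣≋ A = Σ Poly λ Q → Q *ₚ D ≋ A

∣≋⇒∣ : ∀ {D A} → D ∣≋ A → D ∣ A
∣≋⇒∣ (Q , e) = Q , ≋⇒≈ e

∣⇒∣≋ : ∀ {D A} → D ∣ A → D ∣≋ A
∣⇒∣≋ (Q , e) = Q , ≈⇒≋ e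

∣≋-refl : ∀ {D} → D ∣≋ D
∣≋-refl {D} = oneP , *ₚ-identityˡ D

∣≋-resp : ∀ {D D′ A A′} → D ≋ D′ → A ≋ A′ → D ∣≋ A → D′ ∣≋ A′
∣≋-resp e f (Q , QD≋A) = Q , ≋-trans (*ₚ-congʳ Q (≋-sym e)) (≋-trans QD≋A f)

∣≋-trans : ∀ {D A B} → D ∣≋ A → A ∣≋ B → D ∣≋ B
∣≋-trans {D} (Q , QD≋A) (Q′ , Q′A≋B) = Q′ *ₚ Q , ≋-trans (*ₚ-assoc Q′ Q D) (≋-trans (*ₚ-congʳ Q′ QD≋A) Q′A≋B)

∣≋-*ˡ : ∀ {D} A → D ∣≋ A *ₚ D
∣≋-*ˡ A = A , ≋-refl

∣≋-*ʳ : ∀ {D} A → D ∣≋ D *ₚ A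
∣≋-*ʳ {D} A = A , *ₚ-comm A D

∣≋-+ : ∀ {D A B} → D ∣≋ A → D ∣≋ B → D ∣≋ A +ₚ B
∣≋-+ {D} (Q , QD≋A) (Q′ , Q′D≋B) = Q +ₚ Q′ , ≋-trans (*ₚ-distribʳ-+ D Q Q′) (+ₚ-cong QD≋A Q′D≋B)

∣≋-0 : ∀ {D A} → A ≋ [] → D ∣≋ A
∣≋-0 e = [] , ≋-sym e

≋0? : ∀ p → Dec (p ≋ [])
≋0? p with ≋0⊎hasDeg p
... | inj₁ p≋0 = yes p≋0
... | inj₂ (_ , dp) = no (hasDeg⇒≉0 dp)

remainder-∤ : ∀ {D d R} → HasDeg D d → VanishesFrom R d → ¬ (R ≋ []) → ¬ (D ∣≋ R)
remainder-∤ {D} dD vR R≉0 (Q , QD≋R) with ≋0⊎hasDeg Q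
... | inj₁ Q≋0 = R≉0 (≋-trans (≋-sym QD≋R) (*ₚ-zeroˡ-≋ Q≋0 D))
... | inj₂ (_ , dQ) = <-irrefl refl (≤-trans (hasDeg<vanishes (hasDeg-≋ QD≋R (hasDeg-* dQ dD)) vR) (m≤n+m _ _))

∣≋? : ∀ D A → Dec (D ∣≋ A)
∣≋? D A with ≋0⊎hasDeg D
... | inj₁ D≋0 with ≋0? A
...   | yes A≋0 = yes (∣≋-0 A≋0)
...   | no A≉0 = no λ (Q , QD≋A) → A≉0 (≋-trans (≋-sym QD≋A) (*ₚ-zeroʳ-≋ Q D≋0))
∣≋? D A | inj₂ (d , dD) with divMod A dD
... | Q , R , A≋QD+R , vR with ≋0? R
...   | yes R≋0 = yes (Q , ≋-sym (≋-trans A≋QD+R (+ₚ-identityʳ-≋ (Q *ₚ D) R≋0)))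
...   | no R≉0 = no λ D∣A → remainder-∤ dD vR R≉0
                   (∣≋-resp ≋-refl (≋-sym (+ₚ-moveʳ A≋QD+R)) (∣≋-+ D∣A (∣≋-*ˡ Q)))

-- Irreducible polynomials and Euclid's lemma

oneP≉0 : ¬ (oneP ≋ [])
oneP≉0 e with coeff≡ e zero
... | ()

oneP-deg : HasDeg oneP 0
oneP-deg = refl , vanishes λ { (suc k) _ → refl }

hasDeg0⇒≋1 : ∀ {r} → HasDeg r 0 → r ≋ oneP
hasDeg0⇒≋1 (lead , v) = mk≋ λ { zero → lead ; (suc i) → coeff-vanishes v (suc i) (s≤s z≤n) }

∣≋1⇒≋1 : ∀ {D} → D ∣≋ oneP → D ≋ oneP
∣≋1⇒≋1 {D} (Q , QD≋1) with ≋0⊎hasDeg Q | ≋0⊎hasDeg D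
... | inj₁ Q≋0 | _ = ⊥-elim (oneP≉0 (≋-trans (≋-sym QD≋1) (*ₚ-zeroˡ-≋ Q≋0 D)))
... | inj₂ _ | inj₁ D≋0 = ⊥-elim (oneP≉0 (≋-trans (≋-sym QD≋1) (*ₚ-zeroʳ-≋ Q D≋0)))
... | inj₂ (q , dQ) | inj₂ (d , dD) with refl ← m+n≡0⇒n≡0 q (hasDeg-unique (hasDeg-≋ QD≋1 (hasDeg-* dQ dD)) oneP-deg) =
  hasDeg0⇒≋1 dD

irreducible-divisor : ∀ {P D} → Irreducible P → D ∣≋ P → D ≋ oneP ⊎ D ≋ P
irreducible-divisor (_ , _ , divisors) D∣P with divisors _ (∣≋⇒∣ D∣P)
... | inj₁ D≈1 = inj₁ (≈⇒≋ D≈1)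
... | inj₂ D≈P = inj₂ (≈⇒≋ D≈P)

irreducible-≉0 : ∀ {P} → Irreducible P → ¬ (P ≋ [])
irreducible-≉0 (P≉0 , _) P≋0 = P≉0 (≋⇒≈ P≋0)

irreducible-deg : ∀ {P} → Irreducible P → ∃[ t ] HasDeg P (suc t)
irreducible-deg {P} (P≉0 , P≉1 , _) with ≋0⊎hasDeg P
... | inj₁ P≋0 = ⊥-elim (P≉0 (≋⇒≈ P≋0))
... | inj₂ (zero , dP) = ⊥-elim (P≉1 (≋⇒≈ (hasDeg0⇒≋1 dP)))
... | inj₂ (suc t , dP) = t , dP

irreducible-∤1 : ∀ {P} → Irreducible P → ¬ (P ∣≋ oneP)
irreducible-∤1 irr P∣1 with () ← hasDeg-unique (hasDeg-≋ (∣≋1⇒≋1 P∣1) (proj₂ (irreducible-deg irr))) oneP-deg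

module _ {P} (irr : Irreducible P) where

  private
    t : ℕ
    t = suc (proj₁ (irreducible-deg {P} irr))

    dP : HasDeg P t
    dP = proj₂ (irreducible-deg {P} irr)

  -- Dividing P by r leaves a remainder u of smaller degree with P ∣ u B, unless r ∣ P;
  -- then irreducibility and deg r < deg P force r ≋ 1.
  ∣-cancel-small : ∀ {k} → Acc _<_ k → ∀ {r B} → HasDeg r k → k < t → P ∣≋ r *ₚ B → P ∣≋ B
  ∣-cancel-small (acc smaller) {r} {B} dr k<t P∣rB with divMod P dr
  ... | s , u , P≋sr+u , vu with ≋0⊎hasDeg u
  ...   | inj₁ u≋0 with irreducible-divisor irr (s , ≋-sym (≋-trans P≋sr+u (+ₚ-identityʳ-≋ (s *ₚ r) u≋0)))
  ...     | inj₁ r≋1 = ∣≋-resp ≋-refl (≋-trans (*ₚ-congˡ r≋1 B) (*ₚ-identityˡ B)) P∣rB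
  ...     | inj₂ r≋P with refl ← hasDeg-unique (hasDeg-≋ r≋P dr) dP = ⊥-elim (<-irrefl refl k<t)
  ∣-cancel-small (acc smaller) {r} {B} dr k<t P∣rB | s , u , P≋sr+u , vu | inj₂ (k′ , du) =
    ∣-cancel-small (smaller k′<k) du (<-trans k′<k k<t) P∣uB
    where
    k′<k : k′ < _
    k′<k = hasDeg<vanishes du vu
    uB≋PB+srB : u *ₚ B ≋ P *ₚ B +ₚ s *ₚ (r *ₚ B)
    uB≋PB+srB = ≋-trans (*ₚ-congˡ (+ₚ-moveʳ P≋sr+u) B)
                        (≋-trans (*ₚ-distribʳ-+ B P (s *ₚ r)) (+ₚ-cong ≋-refl (*ₚ-assoc s r B)))
    P∣uB : P ∣≋ u *ₚ B
    P∣uB = ∣≋-resp ≋-refl (≋-sym uB≋PB+srB) (∣≋-+ (∣≋-*ʳ B) (∣≋-trans P∣rB (∣≋-*ˡ s)))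

  euclid : ∀ A B → P ∣≋ A *ₚ B → P ∣≋ A ⊎ P ∣≋ B
  euclid A B P∣AB with ∣≋? P A
  ... | yes P∣A = inj₁ P∣A
  ... | no P∤A with divMod A dP
  ...   | Q , R , A≋QP+R , vR with ≋0⊎hasDeg R
  ...     | inj₁ R≋0 = ⊥-elim (P∤A (Q , ≋-sym (≋-trans A≋QP+R (+ₚ-identityʳ-≋ (Q *ₚ P) R≋0))))
  ...     | inj₂ (k , dR) = inj₂ (∣-cancel-small (<-wellFounded k) dR (hasDeg<vanishes dR vR) P∣RB)
    where
    RB≋AB+QPB : R *ₚ B ≋ A *ₚ B +ₚ (Q *ₚ P) *ₚ B
    RB≋AB+QPB = ≋-trans (*ₚ-congˡ (+ₚ-moveʳ A≋QP+R) B) (*ₚ-distribʳ-+ B A (Q *ₚ P))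
    P∣RB : P ∣≋ R *ₚ B
    P∣RB = ∣≋-resp ≋-refl (≋-sym RB≋AB+QPB) (∣≋-+ P∣AB (∣≋-trans (∣≋-*ˡ Q) (∣≋-*ʳ B)))

-- Multiplicities

*ₚ-interchange : ∀ a b c d → (a *ₚ b) *ₚ (c *ₚ d) ≋ (a *ₚ c) *ₚ (b *ₚ d)
*ₚ-interchange = ring 4 (λ a b c d → (a ⊗ b) ⊗ (c ⊗ d) ≐ (a ⊗ c) ⊗ (b ⊗ d)) ≋-refl

^ₚ-≉0 : ∀ {T} → ¬ (T ≋ []) → ∀ i → ¬ (T ^ₚ i ≋ [])
^ₚ-≉0 T≉0 zero = oneP≉0
^ₚ-≉0 T≉0 (suc i) = *ₚ-≉0 T≉0 (^ₚ-≉0 T≉0 i)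

^ₚ-+ : ∀ T a b → T ^ₚ (a + b) ≋ T ^ₚ a *ₚ T ^ₚ b
^ₚ-+ T zero b = ≋-sym (*ₚ-identityˡ _)
^ₚ-+ T (suc a) b = ≋-trans (*ₚ-congʳ T (^ₚ-+ T a b)) (≋-sym (*ₚ-assoc T _ _))

*ₚ-cancelˡ : ∀ {T U V} → ¬ (T ≋ []) → T *ₚ U ≋ T *ₚ V → U ≋ V
*ₚ-cancelˡ {T} {U} {V} T≉0 TU≋TV with ≋0? (U +ₚ V)
... | no U+V≉0 = ⊥-elim (*ₚ-≉0 T≉0 U+V≉0
        (≋-trans (*ₚ-distribˡ-+ T U V) (≋-trans (+ₚ-cong TU≋TV ≋-refl) (+ₚ-self (T *ₚ V)))))
... | yes U+V≋0 = ≋-trans (ring 2 (λ u v → u ≐ (u ⊕ v) ⊕ v) ≋-refl U V) (+ₚ-cong U+V≋0 ≋-refl)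

module _ {T} (irr : Irreducible T) where

  private
    T≉0 : ¬ (T ≋ [])
    T≉0 = irreducible-≉0 irr

  *ₚ-∤ : ∀ {U V} → ¬ (T ∣≋ U) → ¬ (T ∣≋ V) → ¬ (T ∣≋ U *ₚ V)
  *ₚ-∤ T∤U T∤V T∣UV with euclid irr _ _ T∣UV
  ... | inj₁ T∣U = T∤U T∣U
  ... | inj₂ T∣V = T∤V T∣V

  Multiplicity : Poly → Set
  Multiplicity E = Σ ℕ λ i → Σ Poly λ D → (E ≋ T ^ₚ i *ₚ D) × ¬ (T ∣≋ D)

  multiplicity-acc : ∀ {k} → Acc _<_ k → ∀ {E} → HasDeg E k → Multiplicity E
  multiplicity-acc (acc smaller) {E} dE with ∣≋? T E
  ... | no T∤E = 0 , E , ≋-sym (*ₚ-identityˡ E) , T∤E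
  ... | yes (Q , QT≋E) with ≋0⊎hasDeg Q
  ...   | inj₁ Q≋0 = ⊥-elim (hasDeg⇒≉0 dE (≋-trans (≋-sym QT≋E) (*ₚ-zeroˡ-≋ Q≋0 T)))
  ...   | inj₂ (q , dQ) with multiplicity-acc (smaller q<k) dQ
    where
    q<k : q < _
    q<k with refl ← hasDeg-unique (hasDeg-≋ QT≋E (hasDeg-* dQ (proj₂ (irreducible-deg {T} irr)))) dE = m<m+n q (s≤s z≤n)
  ...     | i , D , Q≋TⁱD , T∤D = suc i , D , E≋T·TⁱD , T∤D
    where
    E≋T·TⁱD : E ≋ T ^ₚ suc i *ₚ D
    E≋T·TⁱD = ≋-trans (≋-sym QT≋E)
                (≋-trans (*ₚ-comm Q T) (≋-trans (*ₚ-congʳ T Q≋TⁱD) (≋-sym (*ₚ-assoc T _ D))))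

  multiplicity : ∀ E → ¬ (E ≋ []) → Multiplicity E
  multiplicity E E≉0 with ≋0⊎hasDeg E
  ... | inj₁ E≋0 = ⊥-elim (E≉0 E≋0)
  ... | inj₂ (k , dE) = multiplicity-acc (<-wellFounded k) dE

  T∣T^suc : ∀ b V → T ∣≋ T ^ₚ suc b *ₚ V
  T∣T^suc b V = T ^ₚ b *ₚ V , ≋-trans (*ₚ-comm _ T) (≋-sym (*ₚ-assoc T _ V))

  multiplicity-unique : ∀ a b {U V} → ¬ (T ∣≋ U) → ¬ (T ∣≋ V) → T ^ₚ a *ₚ U ≋ T ^ₚ b *ₚ V →
                        a ≡ b × U ≋ V
  multiplicity-unique zero zero {U} {V} _ _ e = refl , ≋-trans (≋-sym (*ₚ-identityˡ U)) (≋-trans e (*ₚ-identityˡ V))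
  multiplicity-unique zero (suc b) {U} {V} T∤U _ e =
    ⊥-elim (T∤U (∣≋-resp ≋-refl (≋-trans (≋-sym e) (*ₚ-identityˡ U)) (T∣T^suc b V)))
  multiplicity-unique (suc a) zero {U} {V} _ T∤V e =
    ⊥-elim (T∤V (∣≋-resp ≋-refl (≋-trans e (*ₚ-identityˡ V)) (T∣T^suc a U)))
  multiplicity-unique (suc a) (suc b) {U} {V} T∤U T∤V e
    with refl , U≋V ← multiplicity-unique a b T∤U T∤V
           (*ₚ-cancelˡ T≉0 (≋-trans (≋-sym (*ₚ-assoc T _ U)) (≋-trans e (*ₚ-assoc T _ V)))) = refl , U≋V

  module _ (e : ℕ) {C} (T∤C : ¬ (T ∣≋ C)) where

    private
      C≉0 : ¬ (C ≋ [])
      C≉0 C≋0 = T∤C (∣≋-0 C≋0)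

      N≉0 : ¬ (T ^ₚ e *ₚ C ≋ [])
      N≉0 = *ₚ-≉0 (^ₚ-≉0 T≉0 e) C≉0

    -- If E F ≋ Tᵉ C with E ≋ Tⁱ D and F ≋ Tʲ G, uniqueness of multiplicities gives j + i ≡ e and G D ≋ C.
    ∣-^-*⁻ : ∀ {E} → E ∣≋ T ^ₚ e *ₚ C →
             Σ ℕ λ i → Σ Poly λ D → (E ≋ T ^ₚ i *ₚ D) × i ≤ e × D ∣≋ C × ¬ (T ∣≋ D)
    ∣-^-*⁻ {E} (F , FE≋N) = split (multiplicity E E≉0) (multiplicity F F≉0)
      where
      E≉0 : ¬ (E ≋ [])
      E≉0 E≋0 = N≉0 (≋-trans (≋-sym FE≋N) (≋-trans (*ₚ-comm F E) (*ₚ-zeroˡ-≋ E≋0 F)))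
      F≉0 : ¬ (F ≋ [])
      F≉0 F≋0 = N≉0 (≋-trans (≋-sym FE≋N) (*ₚ-zeroˡ-≋ F≋0 E))
      FE-shape : ∀ {i j D G} → E ≋ T ^ₚ i *ₚ D → F ≋ T ^ₚ j *ₚ G → F *ₚ E ≋ T ^ₚ (j + i) *ₚ (G *ₚ D)
      FE-shape {i} {j} {D} {G} E≋TⁱD F≋TʲG = ≋-trans (*ₚ-cong F≋TʲG E≋TⁱD)
        (≋-trans (*ₚ-interchange (T ^ₚ j) G (T ^ₚ i) D)
        (*ₚ-congˡ (≋-sym (^ₚ-+ T j i)) (G *ₚ D)))
      split : Multiplicity E → Multiplicity F →
              Σ ℕ λ i → Σ Poly λ D → (E ≋ T ^ₚ i *ₚ D) × i ≤ e × D ∣≋ C × ¬ (T ∣≋ D)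
      split (i , D , E≋TⁱD , T∤D) (j , G , F≋TʲG , T∤G) =
        i , D , E≋TⁱD , subst (i ≤_) j+i≡e (m≤n+m i j) , (G , GD≋C) , T∤D
        where
        j+i≡e×GD≋C : j + i ≡ e × G *ₚ D ≋ C
        j+i≡e×GD≋C = multiplicity-unique (j + i) e (*ₚ-∤ T∤G T∤D) T∤C
                       (≋-trans (≋-sym (FE-shape {i} {j} E≋TⁱD F≋TʲG)) FE≋N)
        j+i≡e : j + i ≡ e
        j+i≡e = proj₁ j+i≡e×GD≋C
        GD≋C : G *ₚ D ≋ C
        GD≋C = proj₂ j+i≡e×GD≋C

    ∣-^-*⁺ : ∀ {i D} → i ≤ e → D ∣≋ C → T ^ₚ i *ₚ D ∣≋ T ^ₚ e *ₚ C
    ∣-^-*⁺ {i} {D} i≤e (G , GD≋C) with m , refl ← m≤n⇒∃[o]m+o≡n i≤e =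
      T ^ₚ m *ₚ G ,
      ≋-trans (≋-trans (*ₚ-interchange (T ^ₚ m) G (T ^ₚ i) D) (*ₚ-congˡ (*ₚ-comm (T ^ₚ m) (T ^ₚ i)) (G *ₚ D)))
              (*ₚ-cong (≋-sym (^ₚ-+ T i m)) GD≋C)

-- Divisor lists and σ

sumP-++ : ∀ xs ys → sumP (xs ++ ys) ≋ sumP xs +ₚ sumP ys
sumP-++ [] ys = ≋-refl
sumP-++ (x ∷ xs) ys = ≋-trans (+ₚ-cong {x} ≋-refl (sumP-++ xs ys)) (≋-sym (+ₚ-assoc x _ _))

sumP-map-norm-* : ∀ P xs → sumP (map (λ D → norm (P *ₚ D)) xs) ≋ P *ₚ sumP xs
sumP-map-norm-* P [] = ≋-sym (*ₚ-zeroʳ P)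
sumP-map-norm-* P (x ∷ xs) =
  ≋-trans (+ₚ-cong (norm-≋ (P *ₚ x)) (sumP-map-norm-* P xs)) (≋-sym (*ₚ-distribˡ-+ P x (sumP xs)))

-- Duplicate-free lists with the same members are permutations of each other.
sumP-unique-set : ∀ {xs ys} → Unique xs → Unique ys →
                  (∀ {z} → z ∈ xs → z ∈ ys) → (∀ {z} → z ∈ ys → z ∈ xs) → sumP xs ≋ sumP ys
sumP-unique-set uxs uys xs⊆ys ys⊆xs =
  Permutation.foldr-commMonoid (CommutativeSemiring.setoid polySemiring)
    (CommutativeSemiring.+-isCommutativeMonoid polySemiring)
    (↭⇒↭ₛ′ ≋-isEquivalence (∼bag⇒↭ (unique∧set⇒bag uxs uys (mk⇔ xs⊆ys ys⊆xs))))

map-unique : ∀ (f : Poly → Poly) {xs} → (∀ {a b} → a ∈ xs → b ∈ xs → f a ≡ f b → a ≡ b) →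
             Unique xs → Unique (map f xs)
map-unique f {[]} _ [] = []
map-unique f {x ∷ xs} injective (x∉xs ∷ uxs) =
  All.tabulate fx∉ ∷ map-unique f (λ a∈ b∈ → injective (there a∈) (there b∈)) uxs
  where
  fx∉ : ∀ {y} → y ∈ map f xs → ¬ (f x ≡ y)
  fx∉ y∈ fx≡y with ∈-map⁻ f y∈
  ... | b , b∈ , refl = All.lookup x∉xs b∈ (injective (here refl) (there b∈) fx≡y)

record IsDivisorList (A : Poly) (L : List Poly) : Set where
  field
    normal : ∀ {D} → D ∈ L → Normal D
    unique : Unique L
    sound : ∀ {D} → D ∈ L → ¬ (D ≋ []) × D ∣≋ A
    complete : ∀ {D} → Normal D → ¬ (D ≋ []) → D ∣≋ A → D ∈ L

fromDivisorList : ∀ {A L} → DivisorList A L → IsDivisorList A L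
fromDivisorList (normals , unique , members) = record
  { normal = λ D∈ → All.lookup normals D∈
  ; unique = unique
  ; sound = λ D∈ → let (D≉0 , D∣A) = proj₁ (members _ (All.lookup normals D∈)) D∈
                   in (λ D≋0 → D≉0 (≋⇒≈ D≋0)) , ∣⇒∣≋ D∣A
  ; complete = λ n D≉0 D∣A → proj₂ (members _ n) ((λ D≈0 → D≉0 (≈⇒≋ D≈0)) , ∣≋⇒∣ D∣A) }

toDivisorList : ∀ {A L} → IsDivisorList A L → DivisorList A L
toDivisorList d = All.tabulate normal , unique , λ D n →
  (λ D∈ → let (D≉0 , D∣A) = sound D∈ in (λ D≈0 → D≉0 (≈⇒≋ D≈0)) , ∣≋⇒∣ D∣A) ,
  (λ (D≉0 , D∣A) → complete n (λ D≋0 → D≉0 (≋⇒≈ D≋0)) (∣⇒∣≋ D∣A))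
  where open IsDivisorList d

isDivisorList-resp : ∀ {A A′ L} → A ≋ A′ → IsDivisorList A L → IsDivisorList A′ L
isDivisorList-resp A≋A′ d = record
  { normal = normal ; unique = unique
  ; sound = λ D∈ → proj₁ (sound D∈) , ∣≋-resp ≋-refl A≋A′ (proj₂ (sound D∈))
  ; complete = λ n D≉0 D∣A′ → complete n D≉0 (∣≋-resp ≋-refl (≋-sym A≋A′) D∣A′) }
  where open IsDivisorList d

sumP-divisorList-unique : ∀ {A L L′} → IsDivisorList A L → IsDivisorList A L′ → sumP L ≋ sumP L′
sumP-divisorList-unique d d′ = sumP-unique-set (unique d) (unique d′)
  (λ D∈ → complete d′ (normal d D∈) (proj₁ (sound d D∈)) (proj₂ (sound d D∈)))
  (λ D∈ → complete d (normal d′ D∈) (proj₁ (sound d′ D∈)) (proj₂ (sound d′ D∈)))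
  where open IsDivisorList

isDivisorList-filter : ∀ {A C L} → IsDivisorList A L → C ∣≋ A → IsDivisorList C (filter (λ D → ∣≋? D C) L)
isDivisorList-filter {A} {C} {L} d C∣A = record
  { normal = λ D∈ → normal (proj₁ (∈-filter⁻ ∣C? {xs = L} D∈))
  ; unique = Unique.filter⁺ ∣C? unique
  ; sound = λ D∈ → proj₁ (sound (proj₁ (∈-filter⁻ ∣C? {xs = L} D∈))) , proj₂ (∈-filter⁻ ∣C? {xs = L} D∈)
  ; complete = λ n D≉0 D∣C → ∈-filter⁺ ∣C? (complete n D≉0 (∣≋-trans D∣C C∣A)) D∣C }
  where
  open IsDivisorList d
  ∣C? : ∀ D → Dec (D ∣≋ C)
  ∣C? D = ∣≋? D C

isDivisorList-oneP : IsDivisorList oneP (oneP ∷ [])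
isDivisorList-oneP = record
  { normal = λ { (here refl) → refl }
  ; unique = [] ∷ []
  ; sound = λ { (here refl) → oneP≉0 , ∣≋-refl }
  ; complete = λ n _ D∣1 → here (normal-≋⇒≡ n refl (∣≋1⇒≋1 D∣1)) }

-- 1 + T + ⋯ + Tᵏ, which is σ(Tᵏ) for irreducible T (isSigma-^).
sigmaPow : Poly → ℕ → Poly
sigmaPow T zero = oneP
sigmaPow T (suc k) = T ^ₚ suc k +ₚ sigmaPow T k

module _ {T} (irr : Irreducible T) (e : ℕ) {C} (T∤C : ¬ (T ∣≋ C)) {LC} (LC-divisors : IsDivisorList C LC) where

  open IsDivisorList LC-divisors

  private
    T∤LC : ∀ {D} → D ∈ LC → ¬ (T ∣≋ D)
    T∤LC D∈ T∣D = T∤C (∣≋-trans T∣D (proj₂ (sound D∈)))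

  layer : ℕ → List Poly
  layer i = map (λ D → norm (T ^ₚ i *ₚ D)) LC

  layers : ℕ → List Poly
  layers zero = layer 0
  layers (suc k) = layer (suc k) ++ layers k

  ∈-layers⁻ : ∀ k {E} → E ∈ layers k → Σ ℕ λ i → Σ Poly λ D → i ≤ k × D ∈ LC × E ≡ norm (T ^ₚ i *ₚ D)
  ∈-layers⁻ zero E∈ with D , D∈ , refl ← ∈-map⁻ _ E∈ = 0 , D , z≤n , D∈ , refl
  ∈-layers⁻ (suc k) E∈ with ∈-++⁻ (layer (suc k)) E∈
  ... | inj₁ E∈layer with D , D∈ , refl ← ∈-map⁻ _ E∈layer = suc k , D , ≤-refl , D∈ , refl
  ... | inj₂ E∈layers with i , D , i≤k , D∈ , refl ← ∈-layers⁻ k E∈layers = i , D , m≤n⇒m≤1+n i≤k , D∈ , refl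

  ∈-layers⁺ : ∀ k {i D} → i ≤ k → D ∈ LC → norm (T ^ₚ i *ₚ D) ∈ layers k
  ∈-layers⁺ zero z≤n D∈ = ∈-map⁺ _ D∈
  ∈-layers⁺ (suc k) {i} i≤1+k D∈ with m≤n⇒m<n∨m≡n i≤1+k
  ... | inj₁ i<1+k = ∈-++⁺ʳ (layer (suc k)) (∈-layers⁺ k (≤-pred i<1+k) D∈)
  ... | inj₂ refl = ∈-++⁺ˡ (∈-map⁺ _ D∈)

  layer-unique : ∀ i → Unique (layer i)
  layer-unique i = map-unique _ injective unique
    where
    injective : ∀ {a b} → a ∈ LC → b ∈ LC → norm (T ^ₚ i *ₚ a) ≡ norm (T ^ₚ i *ₚ b) → a ≡ b
    injective a∈ b∈ eq = normal-≋⇒≡ (normal a∈) (normal b∈) (*ₚ-cancelˡ (^ₚ-≉0 (irreducible-≉0 irr) i) (≈⇒≋ eq))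

  layers-unique : ∀ k → Unique (layers k)
  layers-unique zero = layer-unique 0
  layers-unique (suc k) = Unique.++⁺ (layer-unique (suc k)) (layers-unique k) disjoint
    where
    disjoint : Disjoint (layer (suc k)) (layers k)
    disjoint (E∈layer , E∈layers) with D , D∈ , refl ← ∈-map⁻ _ E∈layer
      with i , D′ , i≤k , D′∈ , eq ← ∈-layers⁻ k E∈layers
      = <-irrefl (sym (proj₁ (multiplicity-unique irr (suc k) i (T∤LC D∈) (T∤LC D′∈) (≈⇒≋ eq)))) (s≤s i≤k)

  layers-isDivisorList : IsDivisorList (T ^ₚ e *ₚ C) (layers e)
  layers-isDivisorList = record
    { normal = λ E∈ → layer-normal (∈-layers⁻ e E∈)
    ; unique = layers-unique e
    ; sound = λ E∈ → layer-sound (∈-layers⁻ e E∈)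
    ; complete = λ E-normal E≉0 E∣N → layer-complete E-normal E≉0 (∣-^-*⁻ irr e T∤C E∣N) }
    where
    LayerElem : Poly → Set
    LayerElem E = Σ ℕ λ i → Σ Poly λ D → i ≤ e × D ∈ LC × E ≡ norm (T ^ₚ i *ₚ D)
    layer-normal : ∀ {E} → LayerElem E → Normal E
    layer-normal (i , D , _ , _ , refl) = norm-normal (T ^ₚ i *ₚ D)
    layer-sound : ∀ {E} → LayerElem E → ¬ (E ≋ []) × E ∣≋ T ^ₚ e *ₚ C
    layer-sound (i , D , i≤e , D∈ , refl) =
      (λ E≋0 → *ₚ-≉0 (^ₚ-≉0 (irreducible-≉0 irr) i) (proj₁ (sound D∈))
                        (≋-trans (≋-sym (norm-≋ (T ^ₚ i *ₚ D))) E≋0)) ,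
      ∣≋-resp (≋-sym (norm-≋ (T ^ₚ i *ₚ D))) ≋-refl (∣-^-*⁺ irr e T∤C i≤e (proj₂ (sound D∈)))
    layer-complete : ∀ {E} → Normal E → ¬ (E ≋ []) →
                     Σ ℕ (λ i → Σ Poly λ D → (E ≋ T ^ₚ i *ₚ D) × i ≤ e × D ∣≋ C × ¬ (T ∣≋ D)) → E ∈ layers e
    layer-complete {E} E-normal E≉0 (i , D , E≋TⁱD , i≤e , D∣C , _) =
      subst (_∈ layers e) (sym E≡) (∈-layers⁺ e i≤e normD∈)
      where
      D≉0 : ¬ (D ≋ [])
      D≉0 D≋0 = E≉0 (≋-trans E≋TⁱD (*ₚ-zeroʳ-≋ (T ^ₚ i) D≋0))
      normD∈ : norm D ∈ LC
      normD∈ = complete (norm-normal D) (λ normD≋0 → D≉0 (≋-trans (≋-sym (norm-≋ D)) normD≋0))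
                        (∣≋-resp (≋-sym (norm-≋ D)) ≋-refl D∣C)
      E≡ : E ≡ norm (T ^ₚ i *ₚ norm D)
      E≡ = normal-≋⇒≡ E-normal (norm-normal (T ^ₚ i *ₚ norm D))
             (≋-trans E≋TⁱD (≋-trans (*ₚ-congʳ (T ^ₚ i) (≋-sym (norm-≋ D)))
                                     (≋-sym (norm-≋ (T ^ₚ i *ₚ norm D)))))

  sumP-layers : ∀ k → sumP (layers k) ≋ sigmaPow T k *ₚ sumP LC
  sumP-layers zero = sumP-map-norm-* oneP LC
  sumP-layers (suc k) = ≋-trans (sumP-++ (layer (suc k)) (layers k))
    (≋-trans (+ₚ-cong (sumP-map-norm-* (T ^ₚ suc k) LC) (sumP-layers k))
    (≋-sym (*ₚ-distribʳ-+ (sumP LC) (T ^ₚ suc k) (sigmaPow T k))))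

isSigma-^ : ∀ {T} → Irreducible T → ∀ e → ∃[ S ] (IsSigma (T ^ₚ e) S × S ≋ sigmaPow T e)
isSigma-^ {T} irr e = sumP (layers₁ e) , (layers₁ e , toDivisorList Tᵉ-layers , refl) , (begin
  sumP (layers₁ e)              ≈⟨ sumP-layers irr e T∤1 isDivisorList-oneP e ⟩
  sigmaPow T e *ₚ (oneP +ₚ [])  ≈⟨ *ₚ-congʳ (sigmaPow T e) (+ₚ-identityʳ oneP) ⟩
  sigmaPow T e *ₚ oneP          ≈⟨ *ₚ-identityʳ (sigmaPow T e) ⟩
  sigmaPow T e                  ∎)
  where
  T∤1 : ¬ (T ∣≋ oneP)
  T∤1 = irreducible-∤1 irr
  layers₁ : ℕ → List Poly
  layers₁ = layers irr e T∤1 isDivisorList-oneP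
  Tᵉ-layers : IsDivisorList (T ^ₚ e) (layers₁ e)
  Tᵉ-layers = isDivisorList-resp (*ₚ-identityʳ (T ^ₚ e)) (layers-isDivisorList irr e T∤1 isDivisorList-oneP)
  open ≋-Reasoning

sigmaPow-∣-sumP : ∀ {B L} → IsDivisorList B L → ∀ {T e C} → Irreducible T → B ≋ T ^ₚ e *ₚ C → ¬ (T ∣≋ C) →
                  sigmaPow T e ∣≋ sumP L
sigmaPow-∣-sumP {B} {L} B-divisors {T} {e} {C} irr B≋TᵉC T∤C = sumP LC , (begin
  sumP LC *ₚ sigmaPow T e                ≈⟨ *ₚ-comm (sumP LC) (sigmaPow T e) ⟩
  sigmaPow T e *ₚ sumP LC                ≈⟨ sumP-layers irr e T∤C LC-divisors e ⟨
  sumP (layers irr e T∤C LC-divisors e)  ≈⟨ sumP-divisorList-unique B-divisors B-layers ⟨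
  sumP L                                 ∎)
  where
  LC : List Poly
  LC = filter (λ D → ∣≋? D C) L
  LC-divisors : IsDivisorList C LC
  LC-divisors = isDivisorList-filter B-divisors (T ^ₚ e , ≋-sym B≋TᵉC)
  B-layers : IsDivisorList B (layers irr e T∤C LC-divisors e)
  B-layers = isDivisorList-resp (≋-sym B≋TᵉC) (layers-isDivisorList irr e T∤C LC-divisors)
  open ≋-Reasoning

sigmaPow-odd : ∀ T h → oneP +ₚ T ∣≋ sigmaPow T (suc (2 * h))
sigmaPow-odd T zero = oneP , ring 1 (λ t → ⟨ true ⟩ ⊗ (⟨ true ⟩ ⊕ t) ≐ t ⊗ ⟨ true ⟩ ⊕ ⟨ true ⟩) ≋-refl T
sigmaPow-odd T (suc h) =
  subst (λ k → oneP +ₚ T ∣≋ sigmaPow T (suc k)) (sym (*-suc 2 h))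
    (∣≋-resp ≋-refl (≋-sym (sigmaPow-suc-suc (suc (2 * h)))) (∣≋-+ (∣≋-*ʳ _) (sigmaPow-odd T h)))
  where
  sigmaPow-suc-suc : ∀ k → sigmaPow T (suc (suc k)) ≋ (oneP +ₚ T) *ₚ T ^ₚ suc k +ₚ sigmaPow T k
  sigmaPow-suc-suc k =
    ring 3 (λ t u s → t ⊗ u ⊕ (u ⊕ s) ≐ (⟨ true ⟩ ⊕ t) ⊗ u ⊕ s) ≋-refl T (T ^ₚ suc k) (sigmaPow T k)

even⊎odd : ∀ n → ∃[ h ] (n ≡ 2 * h ⊎ n ≡ suc (2 * h))
even⊎odd zero = 0 , inj₁ refl
even⊎odd (suc n) with even⊎odd n
... | h , inj₁ refl = h , inj₂ refl
... | h , inj₂ refl = suc h , inj₁ (sym (*-suc 2 h))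

sumLengths : List Poly → ℕ
sumLengths [] = 0
sumLengths (E ∷ L) = length E + sumLengths L

length-≤-sumLengths : ∀ {E L} → E ∈ L → length E ≤ sumLengths L
length-≤-sumLengths {E} {_ ∷ L} (here refl) = m≤m+n (length E) (sumLengths L)
length-≤-sumLengths {L = F ∷ L} (there E∈) = ≤-trans (length-≤-sumLengths E∈) (m≤n+m (sumLengths L) (length F))

coeff-beyond-length : ∀ E {k} → length E ≤ k → coeff E k ≡ false
coeff-beyond-length [] _ = refl
coeff-beyond-length (_ ∷ E) (s≤s le) = coeff-beyond-length E le

X^-deg : ∀ n → HasDeg (X ^ₚ n) n
X^-deg zero = oneP-deg
X^-deg (suc n) = hasDeg-* {X} (refl , vanishes λ { (suc (suc k)) _ → refl ; (suc zero) (s≤s ()) }) (X^-deg n)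

-- Every power of x divides 0, so a finite list of divisors cannot exist for 0.
isDivisorList⇒≉0 : ∀ {B L} → IsDivisorList B L → ¬ (B ≋ [])
isDivisorList⇒≉0 {B} {L} B-divisors B≋0 =
  ⊥-elim (true≢false (trans (sym coeff-n) (coeff-beyond-length (norm (X ^ₚ n)) (length-≤-sumLengths Xⁿ∈L))))
  where
  open IsDivisorList B-divisors
  n : ℕ
  n = sumLengths L
  coeff-n : coeff (norm (X ^ₚ n)) n ≡ true
  coeff-n = trans (coeff≡ (norm-≋ (X ^ₚ n)) n) (proj₁ (X^-deg n))
  Xⁿ∈L : norm (X ^ₚ n) ∈ L
  Xⁿ∈L = complete (norm-normal (X ^ₚ n)) (hasDeg⇒≉0 (hasDeg-≋ (≋-sym (norm-≋ (X ^ₚ n))) (X^-deg n)))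
                  (∣≋-0 B≋0)
  true≢false : ¬ (true ≡ false)
  true≢false ()

irreducible-divisor-≉1 : ∀ {P D} → Irreducible P → D ∣≋ P → ¬ (D ≋ oneP) → D ≋ P
irreducible-divisor-≉1 irr D∣P D≉1 with irreducible-divisor irr D∣P
... | inj₁ D≋1 = ⊥-elim (D≉1 D≋1)
... | inj₂ D≋P = D≋P

X≉1 : ¬ (X ≋ oneP)
X≉1 X≋1 with coeff≡ X≋1 0
... | ()

X1≉1 : ¬ (X1 ≋ oneP)
X1≉1 X1≋1 with coeff≡ X1≋1 1
... | ()

irreducible-divisor-classify : ∀ {B P} → Irreducible P → P ∣≋ B → withLinear (OddIrreducibleDivisors B) P
irreducible-divisor-classify {B} {P} irr P∣B with ∣≋? X P | ∣≋? X1 P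
... | yes X∣P | _ = inj₂ (inj₁ (≋⇒≈ (≋-sym (irreducible-divisor-≉1 irr X∣P X≉1))))
... | no _ | yes X1∣P = inj₂ (inj₂ (≋⇒≈ (≋-sym (irreducible-divisor-≉1 irr X1∣P X1≉1))))
... | no X∤P | no X1∤P = inj₁ (((λ X∣P → X∤P (∣⇒∣≋ X∣P)) , (λ X1∣P → X1∤P (∣⇒∣≋ X1∣P))) , irr , ∣≋⇒∣ P∣B)

divisor-factorsIn : ∀ {B S} → S ∣≋ B → FactorsIn (withLinear (OddIrreducibleDivisors B)) S
divisor-factorsIn S∣B P irr P∣S = irreducible-divisor-classify irr (∣≋-trans (∣⇒∣≋ P∣S) S∣B)

ConditionIIIAt : Family → Poly → Set
ConditionIIIAt G T =
  FactorsIn (withLinear G) (oneP +ₚ T) ⊎ ∃[ h ] (h ≥ 1 × SigmaFactorsIn (withLinear G) (T ^ₚ (2 * h)))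

perfect-conditionIII : ∀ {B L} → IsDivisorList B L → sumP L ≋ B → ∀ {T} → Irreducible T → T ∣≋ B →
                       ConditionIIIAt (OddIrreducibleDivisors B) T
perfect-conditionIII {B} B-divisors σB≋B {T} irr T∣B =
  by-multiplicity (multiplicity irr B (isDivisorList⇒≉0 B-divisors))
  where
  by-multiplicity : Multiplicity irr B → ConditionIIIAt (OddIrreducibleDivisors B) T
  by-multiplicity (e , C , B≋TᵉC , T∤C) = by-parity (even⊎odd e)
    where
    σTᵉ∣B : sigmaPow T e ∣≋ B
    σTᵉ∣B = ∣≋-resp ≋-refl σB≋B (sigmaPow-∣-sumP B-divisors {T} {e} {C} irr B≋TᵉC T∤C)
    by-parity : ∃[ h ] (e ≡ 2 * h ⊎ e ≡ suc (2 * h)) → ConditionIIIAt (OddIrreducibleDivisors B) T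
    by-parity (zero , inj₁ e≡0) =
      ⊥-elim (T∤C (∣≋-resp ≋-refl (≋-trans B≋TᵉC (≋-trans (*ₚ-congˡ Tᵉ≋1 C) (*ₚ-identityˡ C))) T∣B))
      where
      Tᵉ≋1 : T ^ₚ e ≋ oneP
      Tᵉ≋1 = subst (λ k → T ^ₚ k ≋ oneP) (sym e≡0) ≋-refl
    by-parity (suc h , inj₁ e≡2h) = inj₂ (suc h , s≤s z≤n , σ-factors (isSigma-^ irr e))
      where
      σ-factors : ∃[ S ] (IsSigma (T ^ₚ e) S × S ≋ sigmaPow T e) →
                  SigmaFactorsIn (withLinear (OddIrreducibleDivisors B)) (T ^ₚ (2 * suc h))
      σ-factors (S , S-isSigma , S≋σTᵉ) =
        S , subst (λ k → IsSigma (T ^ₚ k) S) e≡2h S-isSigma , divisor-factorsIn (∣≋-resp (≋-sym S≋σTᵉ) ≋-refl σTᵉ∣B)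
    by-parity (h , inj₂ e≡1+2h) =
      inj₁ (divisor-factorsIn (∣≋-trans (sigmaPow-odd T h) (subst (λ k → sigmaPow T k ∣≋ B) e≡1+2h σTᵉ∣B)))

corollary3p3 : (B : Poly) → Even B → NonSplitting B → Perfect B → Admissible (OddIrreducibleDivisors B)
corollary3p3 B _ _ (L , B-divisorList , σB≈B) =
  (λ T (odd , irr , _) → odd , irr) ,
  inj₂ (inj₂ λ T (_ , irr , T∣B) →
    perfect-conditionIII (fromDivisorList B-divisorList) (≈⇒≋ {sumP L} {B} σB≈B) {T} irr (∣⇒∣≋ {T} {B} T∣B))
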